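{- Let $p$ be a prime, $d,k$ positive integers, $\mathbf N^{(1)},\dots,\mathbf N^{(k)}\in\mathbb{Z}^d$ with $\mathbf N^{(j)}\ge\mathbf 0$. Let $s\ge0$ be an integer and $\mathbf u,\mathbf n\in\mathbb{Z}^d$ with $\mathbf u,\mathbf n\ge\mathbf 0$ and $0\le u_i<p^s$ for $i=1,\dots,d$. Then there exists $\varepsilon\in p^{s+1}\mathbb{Z}_p$ such that $$\frac{B_{\mathbf N}(p\mathbf u+p^{s+1}\mathbf n)}{B_{\mathbf N}(\mathbf u+p^{s}\mathbf n)}=\frac{B_{\mathbf N}(p\mathbf u)}{B_{\mathbf N}(\mathbf u)}\,(1+\varepsilon).$$
   Context: For $\mathbf P,\mathbf m\in\mathbb{Z}^d$ with $\mathbf P,\mathbf m\ge\mathbf 0$, $B(\mathbf P,\mathbf m)=\big(\sum_{i=1}^dP_im_i\big)!\big/\prod_{i=1}^dm_i!^{P_i}$, and $B_{\mathbf N}(\mathbf m)=\prod_{j=1}^kB(\mathbf N^{(j)},\mathbf m)$. Vector inequalities are componentwise. $\mathbb{Z}_p$ denotes the $p$-adic integers. -}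

module Defs where

open import Data.Nat as ℕ using (ℕ; zero; suc; _!; NonZero)
open import Data.Nat.Properties using (m*n≢0; m^n≢0; _!≢0)
open import Data.Fin using (Fin; zero; suc)
open import Data.Integer as ℤ using (ℤ; +_)
open import Data.Rational as ℚ using (ℚ; 0ℚ)
open import Data.Rational.Properties using (_≟_)
open import Data.Nat.Divisibility using (_∣_)
open import Data.Product using (Σ; ∃; _×_)
open import Relation.Nullary using (¬_; yes; no)
open import Relation.Binary.PropositionalEquality using (_≡_)

sumF : ∀ {d} → (Fin d → ℕ) → ℕ
sumF {zero}  f = 0
sumF {suc d} f = f zero ℕ.+ sumF (λ i → f (suc i))

prodF : ∀ {d} → (Fin d → ℕ) → ℕ
prodF {zero}  f = 1
prodF {suc d} f = f zero ℕ.* prodF (λ i → f (suc i))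

prodQ : ∀ {k} → (Fin k → ℚ) → ℚ
prodQ {zero}  f = ℚ.1ℚ
prodQ {suc k} f = f zero ℚ.* prodQ (λ j → f (suc j))

denom : ∀ {d} → (Fin d → ℕ) → (Fin d → ℕ) → ℕ
denom P m = prodF (λ i → (m i !) ℕ.^ P i)

denom≢0 : ∀ {d} (P m : Fin d → ℕ) → NonZero (denom P m)
denom≢0 {zero}  P m = _
denom≢0 {suc d} P m =
  m*n≢0 _ _ {{m^n≢0 (m zero !) (P zero) {{m zero !≢0}}}}
            {{denom≢0 (λ i → P (suc i)) (λ i → m (suc i))}}

B : ∀ {d} → (Fin d → ℕ) → (Fin d → ℕ) → ℚ
B P m = ℚ._/_ (+ (sumF (λ i → P i ℕ.* m i) !)) (denom P m) {{denom≢0 P m}}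

BN : ∀ {k d} → (Fin k → Fin d → ℕ) → (Fin d → ℕ) → ℚ
BN N m = prodQ (λ j → B (N j) m)

-- Division of rationals (total; x ÷ᵗ 0 = 0, never used at 0 here since B > 0)
_÷ᵗ_ : ℚ → ℚ → ℚ
x ÷ᵗ y with y ≟ 0ℚ
... | yes _ = 0ℚ
... | no y≢0 = ℚ._÷_ x y {{ℚ.≢-nonZero y≢0}}

-- A rational ε lies in p^e ℤ_p  iff  ε = p^e · a / b with a ∈ ℤ, b ∈ ℕ, p ∤ b
-- (ℚ ∩ p^e ℤ_p = p^e ℤ_(p)).
InPowZp : ℕ → ℕ → ℚ → Set
InPowZp p e ε = ∃ λ (a : ℤ) → ∃ λ (b : ℕ) → (¬ (p ∣ b)) ×
  Σ (NonZero b) (λ nz → ε ≡ ℚ._/_ (+ (p ℕ.^ e) ℤ.* a) b {{nz}})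

{-# OPTIONS --safe #-}
module Submission where

-- Write (pM)! = p^M · M! · U(M), where U(M) (unitPart) is the product of the integers in
-- [1, pM] prime to p.  The powers of p and the factorials cancel in B_N(pm)/B_N(m), leaving
-- a ratio X(m)/Y(m) (numUnits/denUnits) of products of values of U, all prime to p.
-- Since p(M + K) ≡ pM (mod pK), we have U(M + K) ≡ U(M) U(K) (mod pK); for K = p^s this makes
-- X(u + p^s n) and Y(u + p^s n) congruent mod p^(s+1) to X(u) C and Y(u) C for one and the
-- same C.  Hence X(m′) Y(u) ≡ X(u) Y(m′) (mod p^(s+1)), so the two ratios differ by a factor
-- 1 + ε with ε ∈ p^(s+1) ℤ_p.

open import Defs
open import Data.Nat as ℕ using (ℕ; zero; suc; _+_; _*_; _^_; _<_; _≤_; _!; pred; NonZero)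
import Data.Nat.Properties as ℕ
open import Data.Nat.Divisibility using (∣m+n∣m⇒∣n; m∣m*n; ∣⇒≤; ∣1⇒≡1) renaming (_∣_ to _∣ℕ_)
open import Data.Nat.Primality using (Prime; prime⇒nonZero; ¬prime[1]; euclidsLemma)
open import Data.Fin using (Fin; zero; suc)
open import Data.Integer as ℤ using (ℤ; +_)
import Data.Integer.Properties as ℤ
open import Data.Integer.Divisibility.Signed using (_∣_; divides; ∣m∣n⇒∣m+n; ∣m⇒∣-m; ∣m⇒∣m*n; ∣n⇒∣m*n)
open import Data.Rational as ℚ using (ℚ; 0ℚ; 1ℚ; _/_; toℚᵘ; Positive)
import Data.Rational.Properties as ℚ
open import Data.Rational.Unnormalised as ℚᵘ using (*≡*) renaming (_/_ to _/ᵘ_)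
import Data.Rational.Unnormalised.Properties as ℚᵘ
open import Data.Product using (∃; _×_; _,_; map₂)
open import Data.Sum using (inj₁; inj₂)
open import Relation.Nullary using (¬_; yes; no; contradiction)
open import Relation.Binary.PropositionalEquality
  using (_≡_; _≢_; refl; sym; trans; cong; cong₂; subst; module ≡-Reasoning)
open import Algebra.Bundles using (CommutativeMonoid)
open import Algebra.Properties.CommutativeSemigroup ℕ.+-commutativeSemigroup
  using () renaming (interchange to +-interchange)
open import Algebra.Properties.CommutativeSemigroup ℕ.*-commutativeSemigroup
  using () renaming (interchange to *-interchange)
open import Algebra.Properties.CommutativeSemigroup
  (CommutativeMonoid.commutativeSemigroup ℚ.*-1-commutativeMonoid)
  using () renaming (interchange to ℚ-*-interchange)
import Data.Nat.Tactic.RingSolver as ℕ-Solver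
import Data.Integer.Tactic.RingSolver as ℤ-Solver

infix 4 _≡_mod_

-- A record, not a plain definition, so that a and b can be inferred from the type.
record _≡_mod_ (a b q : ℕ) : Set where
  constructor mk≡mod
  field q∣a-b : + q ∣ + a ℤ.- + b

module _ {q : ℕ} where

  ≡⇒≡mod : ∀ {a b} → a ≡ b → a ≡ b mod q
  ≡⇒≡mod {a} refl = mk≡mod (divides ℤ.0ℤ (trans (ℤ.+-inverseʳ (+ a)) (sym (ℤ.*-zeroˡ (+ q)))))

  ≡mod-sym : ∀ {a b} → a ≡ b mod q → b ≡ a mod q
  ≡mod-sym {a} {b} (mk≡mod h) = mk≡mod (subst (+ q ∣_) (negate (+ a) (+ b)) (∣m⇒∣-m h))
    where negate : ∀ a b → ℤ.- (a ℤ.- b) ≡ b ℤ.- a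
          negate = ℤ-Solver.solve-∀

  ≡mod-trans : ∀ {a b c} → a ≡ b mod q → b ≡ c mod q → a ≡ c mod q
  ≡mod-trans {a} {b} {c} (mk≡mod h) (mk≡mod h′) =
    mk≡mod (subst (+ q ∣_) (telescope (+ a) (+ b) (+ c)) (∣m∣n⇒∣m+n h h′))
    where telescope : ∀ a b c → (a ℤ.- b) ℤ.+ (b ℤ.- c) ≡ a ℤ.- c
          telescope = ℤ-Solver.solve-∀

  +-≡mod : ∀ a → a + q ≡ a mod q
  +-≡mod a = mk≡mod (divides ℤ.1ℤ (trans (cong (ℤ._- + a) (ℤ.pos-+ a q)) (cancel (+ a) (+ q))))
    where cancel : ∀ a q → a ℤ.+ q ℤ.- a ≡ ℤ.1ℤ ℤ.* q
          cancel = ℤ-Solver.solve-∀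

  *-≡mod : ∀ {a b c d} → a ≡ b mod q → c ≡ d mod q → a * c ≡ b * d mod q
  *-≡mod {a} {b} {c} {d} (mk≡mod h) (mk≡mod h′) =
    mk≡mod (subst (+ q ∣_) split (∣m∣n⇒∣m+n (∣m⇒∣m*n (+ c) h) (∣n⇒∣m*n (+ b) h′)))
    where
    identity : ∀ a b c d → (a ℤ.- b) ℤ.* c ℤ.+ b ℤ.* (c ℤ.- d) ≡ a ℤ.* c ℤ.- b ℤ.* d
    identity = ℤ-Solver.solve-∀
    split : (+ a ℤ.- + b) ℤ.* + c ℤ.+ + b ℤ.* (+ c ℤ.- + d) ≡ + (a * c) ℤ.- + (b * d)
    split = trans (identity (+ a) (+ b) (+ c) (+ d))
                  (sym (cong₂ ℤ._-_ (ℤ.pos-* a c) (ℤ.pos-* b d)))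

  ^-≡mod : ∀ {a b} n → a ≡ b mod q → a ^ n ≡ b ^ n mod q
  ^-≡mod zero    h = ≡⇒≡mod refl
  ^-≡mod (suc n) h = *-≡mod h (^-≡mod n h)

  ≡mod-cross : ∀ {a b a′ b′ c} → a ≡ b * c mod q → a′ ≡ b′ * c mod q →
               a * b′ ≡ b * a′ mod q
  ≡mod-cross {a} {b} {a′} {b′} {c} h h′ = ≡mod-trans (*-≡mod h (≡⇒≡mod refl))
    (≡mod-trans (≡⇒≡mod (reorder b c b′)) (*-≡mod (≡⇒≡mod {b} refl) (≡mod-sym h′)))
    where reorder : ∀ b c b′ → b * c * b′ ≡ b * (b′ * c)
          reorder = ℕ-Solver.solve-∀

  ≡mod⇒∃ : ∀ {a b} → a ≡ b mod q → ∃ λ c → + a ≡ + b ℤ.+ + q ℤ.* c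
  ≡mod⇒∃ {a} {b} (mk≡mod (divides c eq)) = c , trans (split (+ a) (+ b))
    (cong (ℤ._+_ (+ b)) (trans eq (ℤ.*-comm c (+ q))))
    where split : ∀ a b → a ≡ b ℤ.+ (a ℤ.- b)
          split = ℤ-Solver.solve-∀

*-^ : ∀ a b n → (a * b) ^ n ≡ a ^ n * b ^ n
*-^ a b zero    = refl
*-^ a b (suc n) = trans (cong (a * b *_) (*-^ a b n)) (*-interchange a b (a ^ n) (b ^ n))

sumF-cong : ∀ {d} {f g : Fin d → ℕ} → (∀ i → f i ≡ g i) → sumF f ≡ sumF g
sumF-cong {zero}  eq = refl
sumF-cong {suc d} eq = cong₂ _+_ (eq zero) (sumF-cong (λ i → eq (suc i)))

sumF-+ : ∀ {d} (f g : Fin d → ℕ) → sumF (λ i → f i + g i) ≡ sumF f + sumF g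
sumF-+ {zero}  f g = refl
sumF-+ {suc d} f g =
  trans (cong (_+_ (f zero + g zero)) (sumF-+ (λ i → f (suc i)) (λ i → g (suc i))))
        (+-interchange (f zero) (g zero) _ _)

sumF-*ˡ : ∀ {d} a (f : Fin d → ℕ) → sumF (λ i → a * f i) ≡ a * sumF f
sumF-*ˡ {zero}  a f = sym (ℕ.*-zeroʳ a)
sumF-*ˡ {suc d} a f = trans (cong (_+_ (a * f zero)) (sumF-*ˡ a (λ i → f (suc i))))
                            (sym (ℕ.*-distribˡ-+ a (f zero) _))

prodF-cong : ∀ {d} {f g : Fin d → ℕ} → (∀ i → f i ≡ g i) → prodF f ≡ prodF g
prodF-cong {zero}  eq = refl
prodF-cong {suc d} eq = cong₂ _*_ (eq zero) (prodF-cong (λ i → eq (suc i)))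

prodF-* : ∀ {d} (f g : Fin d → ℕ) → prodF (λ i → f i * g i) ≡ prodF f * prodF g
prodF-* {zero}  f g = refl
prodF-* {suc d} f g =
  trans (cong (f zero * g zero *_) (prodF-* (λ i → f (suc i)) (λ i → g (suc i))))
        (*-interchange (f zero) (g zero) _ _)

prodF-^ : ∀ {d} c (f : Fin d → ℕ) → prodF (λ i → c ^ f i) ≡ c ^ sumF f
prodF-^ {zero}  c f = refl
prodF-^ {suc d} c f = trans (cong (c ^ f zero *_) (prodF-^ c (λ i → f (suc i))))
                            (sym (ℕ.^-distribˡ-+-* c (f zero) _))

prodF-closed : (P : ℕ → Set) → P 1 → (∀ {a b} → P a → P b → P (a * b)) →
               ∀ {d} (f : Fin d → ℕ) → (∀ i → P (f i)) → P (prodF f)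
prodF-closed P P1 P* {zero}  f Pf = P1
prodF-closed P P1 P* {suc d} f Pf =
  P* (Pf zero) (prodF-closed P P1 P* (λ i → f (suc i)) (λ i → Pf (suc i)))

prodF≢0 : ∀ {d} (f : Fin d → ℕ) → (∀ i → NonZero (f i)) → NonZero (prodF f)
prodF≢0 = prodF-closed NonZero _ (λ {a} {b} a≢0 b≢0 → ℕ.m*n≢0 a b {{a≢0}} {{b≢0}})

prodF-≡mod-* : ∀ {q d} (f g c : Fin d → ℕ) → (∀ i → f i ≡ g i * c i mod q) →
               prodF f ≡ prodF g * prodF c mod q
prodF-≡mod-* {q} {zero}  f g c h = ≡⇒≡mod refl
prodF-≡mod-* {q} {suc d} f g c h = ≡mod-trans
  (*-≡mod (h zero) (prodF-≡mod-* (λ i → f (suc i)) (λ i → g (suc i)) (λ i → c (suc i))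
                                 (λ i → h (suc i))))
  (≡⇒≡mod (*-interchange (g zero) (c zero) _ _))

infix 8 _·_

_·_ : ∀ {d} → (Fin d → ℕ) → (Fin d → ℕ) → ℕ
P · m = sumF (λ i → P i * m i)

·-scale : ∀ {d} (P : Fin d → ℕ) {m m′ : Fin d → ℕ} a → (∀ i → m′ i ≡ a * m i) →
          P · m′ ≡ a * (P · m)
·-scale P {m} a h =
  trans (sumF-cong (λ i → trans (cong (P i *_) (h i)) (swap (P i) a (m i))))
        (sumF-*ˡ a (λ i → P i * m i))
  where swap : ∀ x a y → x * (a * y) ≡ a * (x * y)
        swap = ℕ-Solver.solve-∀

·-shift : ∀ {d} (P u n : Fin d → ℕ) K → P · (λ i → u i + K * n i) ≡ P · u + K * (P · n)
·-shift P u n K = trans (sumF-cong (λ i → expand (P i) (u i) K (n i)))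
  (trans (sumF-+ (λ i → P i * u i) (λ i → K * (P i * n i)))
         (cong (_+_ (P · u)) (sumF-*ˡ K (λ i → P i * n i))))
  where expand : ∀ x u K n → x * (u + K * n) ≡ x * u + K * (x * n)
        expand = ℕ-Solver.solve-∀

rising : ℕ → ℕ → ℕ
rising x zero    = 1
rising x (suc t) = rising x t * suc (x + t)

[x+t]!≡x!*rising : ∀ x t → (x + t) ! ≡ x ! * rising x t
[x+t]!≡x!*rising x zero    = trans (cong _! (ℕ.+-identityʳ x)) (sym (ℕ.*-identityʳ (x !)))
[x+t]!≡x!*rising x (suc t) = begin
  (x + suc t) !                    ≡⟨ cong _! (ℕ.+-suc x t) ⟩
  suc (x + t) * (x + t) !          ≡⟨ cong (suc (x + t) *_) ([x+t]!≡x!*rising x t) ⟩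
  suc (x + t) * (x ! * rising x t) ≡⟨ reorder (suc (x + t)) (x !) (rising x t) ⟩
  x ! * rising x (suc t)           ∎
  where
  open ≡-Reasoning
  reorder : ∀ a b c → a * (b * c) ≡ b * (c * a)
  reorder = ℕ-Solver.solve-∀

rising-+-≡mod : ∀ q x t → rising (x + q) t ≡ rising x t mod q
rising-+-≡mod q x zero    = ≡⇒≡mod refl
rising-+-≡mod q x (suc t) = *-≡mod (rising-+-≡mod q x t)
  (≡mod-trans (≡⇒≡mod (reorder x q t)) (+-≡mod (suc (x + t))))
  where reorder : ∀ x q t → suc (x + q + t) ≡ suc (x + t) + q
        reorder = ℕ-Solver.solve-∀

unitPart : ℕ → ℕ → ℕ
unitPart p zero    = 1
unitPart p (suc M) = unitPart p M * rising (p * M) (pred p)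

[p*M]!≡p^M*M!*unitPart : ∀ p .{{_ : NonZero p}} M → (p * M) ! ≡ p ^ M * M ! * unitPart p M
[p*M]!≡p^M*M!*unitPart p zero    = cong _! (ℕ.*-zeroʳ p)
[p*M]!≡p^M*M!*unitPart p (suc M) = begin
  (p * suc M) !                                     ≡⟨ cong _! p*[1+M]≡1+[p*M+p-1] ⟩
  suc (p * M + pred p) * (p * M + pred p) !         ≡⟨ cong₂ _*_ (sym p*[1+M]≡1+[p*M+p-1])
                                                                 ([x+t]!≡x!*rising (p * M) (pred p)) ⟩
  p * suc M * ((p * M) ! * rising (p * M) (pred p)) ≡⟨ cong (λ f → p * suc M * (f * rising (p * M) (pred p)))
                                                            ([p*M]!≡p^M*M!*unitPart p M) ⟩
  p * suc M * (p ^ M * M ! * unitPart p M * rising (p * M) (pred p))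
                                                    ≡⟨ reorder p M (p ^ M) (M !) (unitPart p M) _ ⟩
  p ^ suc M * suc M ! * unitPart p (suc M)          ∎
  where
  open ≡-Reasoning
  p*[1+M]≡1+[p*M+p-1] : p * suc M ≡ suc (p * M + pred p)
  p*[1+M]≡1+[p*M+p-1] = trans (ℕ.*-suc p M)
    (trans (cong (_+ p * M) (sym (ℕ.suc-pred p))) (cong suc (ℕ.+-comm (pred p) (p * M))))
  reorder : ∀ p M a b c r → p * suc M * (a * b * c * r) ≡ p * a * (suc M * b) * (c * r)
  reorder = ℕ-Solver.solve-∀

unitPart≢0 : ∀ p M → NonZero (unitPart p M)
unitPart≢0 p zero    = _
unitPart≢0 p (suc M) = ℕ.m*n≢0 _ _ {{unitPart≢0 p M}} {{rising≢0 (pred p)}}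
  where rising≢0 : ∀ t → NonZero (rising (p * M) t)
        rising≢0 zero    = _
        rising≢0 (suc t) = ℕ.m*n≢0 _ _ {{rising≢0 t}}

unitPart-+-≡mod : ∀ p M K → unitPart p (M + K) ≡ unitPart p M * unitPart p K mod p * K
unitPart-+-≡mod p zero    K = ≡⇒≡mod (sym (ℕ.*-identityˡ (unitPart p K)))
unitPart-+-≡mod p (suc M) K = ≡mod-trans
  (*-≡mod (unitPart-+-≡mod p M K) rising-shift)
  (≡⇒≡mod (reorder (unitPart p M) (unitPart p K) _))
  where
  rising-shift : rising (p * (M + K)) (pred p) ≡ rising (p * M) (pred p) mod p * K
  rising-shift rewrite ℕ.*-distribˡ-+ p M K = rising-+-≡mod (p * K) (p * M) (pred p)
  reorder : ∀ a b r → a * b * r ≡ a * r * b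
  reorder = ℕ-Solver.solve-∀

unitPart-+*-≡mod : ∀ p M K n →
                   unitPart p (M + K * n) ≡ unitPart p M * unitPart p K ^ n mod p * K
unitPart-+*-≡mod p M K zero    = ≡⇒≡mod (trans (cong (unitPart p) (M+K*0≡M M K))
                                               (sym (ℕ.*-identityʳ (unitPart p M))))
  where M+K*0≡M : ∀ M K → M + K * 0 ≡ M
        M+K*0≡M = ℕ-Solver.solve-∀
unitPart-+*-≡mod p M K (suc n) = ≡mod-trans (≡⇒≡mod (cong (unitPart p) (regroup M K n)))
  (≡mod-trans (unitPart-+-≡mod p (M + K * n) K)
  (≡mod-trans (*-≡mod (unitPart-+*-≡mod p M K n) (≡⇒≡mod refl))
              (≡⇒≡mod (reorder (unitPart p M) (unitPart p K) (unitPart p K ^ n)))))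
  where
  regroup : ∀ M K n → M + K * suc n ≡ M + K * n + K
  regroup = ℕ-Solver.solve-∀
  reorder : ∀ a c e → a * e * c ≡ a * (c * e)
  reorder = ℕ-Solver.solve-∀

toℚᵘ-/ : ∀ i n .{{_ : NonZero n}} → toℚᵘ (i / n) ℚᵘ.≃ (i /ᵘ n)
toℚᵘ-/ i n@(suc _) = ℚ.toℚᵘ-fromℚᵘ (i /ᵘ n)

/-cross : ∀ i j m n .{{_ : NonZero m}} .{{_ : NonZero n}} →
          i ℤ.* + n ≡ j ℤ.* + m → i / m ≡ j / n
/-cross i j m@(suc _) n@(suc _) eq =
  ℚ.toℚᵘ-injective (ℚᵘ.≃-trans (toℚᵘ-/ i m) (ℚᵘ.≃-trans (*≡* eq) (ℚᵘ.≃-sym (toℚᵘ-/ j n))))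

/-*-/ : ∀ i j m n .{{_ : NonZero m}} .{{_ : NonZero n}} →
        (i / m) ℚ.* (j / n) ≡ _/_ (i ℤ.* j) (m * n) {{ℕ.m*n≢0 m n}}
/-*-/ i j m@(suc _) n@(suc _) = ℚ.toℚᵘ-injective
  (ℚᵘ.≃-trans (ℚ.toℚᵘ-homo-* (i / m) (j / n))
  (ℚᵘ.≃-trans (ℚᵘ.*-cong (toℚᵘ-/ i m) (toℚᵘ-/ j n)) (ℚᵘ.≃-sym (toℚᵘ-/ (i ℤ.* j) (m * n)))))

1+/ : ∀ i n .{{_ : NonZero n}} → 1ℚ ℚ.+ i / n ≡ (+ n ℤ.+ i) / n
1+/ i n@(suc _) = ℚ.toℚᵘ-injective (ℚᵘ.≃-trans (ℚ.toℚᵘ-homo-+ 1ℚ (i / n))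
  (ℚᵘ.≃-trans (ℚᵘ.+-congʳ (toℚᵘ 1ℚ) (toℚᵘ-/ i n))
  (ℚᵘ.≃-trans (*≡* (cross (+ n) i)) (ℚᵘ.≃-sym (toℚᵘ-/ (+ n ℤ.+ i) n)))))
  where cross : ∀ n i → (ℤ.1ℤ ℤ.* n ℤ.+ i ℤ.* ℤ.1ℤ) ℤ.* n ≡ (n ℤ.+ i) ℤ.* (ℤ.1ℤ ℤ.* n)
        cross = ℤ-Solver.solve-∀

/-crossℕ : ∀ a c b d .{{_ : NonZero b}} .{{_ : NonZero d}} → a * d ≡ c * b → + a / b ≡ + c / d
/-crossℕ a c b d eq = /-cross (+ a) (+ c) b d
  (trans (sym (ℤ.pos-* a d)) (trans (cong +_ eq) (ℤ.pos-* c b)))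

/-*-/ℕ : ∀ a c b d .{{_ : NonZero b}} .{{_ : NonZero d}} →
         (+ a / b) ℚ.* (+ c / d) ≡ _/_ (+ (a * c)) (b * d) {{ℕ.m*n≢0 b d}}
/-*-/ℕ a c b d = trans (/-*-/ (+ a) (+ c) b d)
  (ℚ./-cong {{ℕ.m*n≢0 b d}} {{ℕ.m*n≢0 b d}} (sym (ℤ.pos-* a c)) refl)

-- (x / y)(1 + e / (x y′)) = (x y′ + e) / (y y′), which is x′ / y′ when x′ y = x y′ + e.
/-perturb : ∀ x y x′ y′ e .{{_ : NonZero x}} .{{_ : NonZero y}} .{{_ : NonZero y′}} →
            + (x′ * y) ≡ + (x * y′) ℤ.+ e →
            + x′ / y′ ≡ (+ x / y) ℚ.* (1ℚ ℚ.+ _/_ e (x * y′) {{ℕ.m*n≢0 x y′}})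
/-perturb x y x′ y′ e eq = sym (begin
  (+ x / y) ℚ.* (1ℚ ℚ.+ e / (x * y′))             ≡⟨ cong (ℚ._*_ (+ x / y)) (1+/ e (x * y′)) ⟩
  (+ x / y) ℚ.* ((+ (x * y′) ℤ.+ e) / (x * y′))   ≡⟨ /-*-/ (+ x) (+ (x * y′) ℤ.+ e) y (x * y′) ⟩
  (+ x ℤ.* (+ (x * y′) ℤ.+ e)) / (y * (x * y′))   ≡⟨ /-cross (+ x ℤ.* (+ (x * y′) ℤ.+ e)) (+ x′) (y * (x * y′)) y′ cross ⟩
  + x′ / y′                                       ∎)
  where
  open ≡-Reasoning
  instance
    xy′≢0 : NonZero (x * y′)
    xy′≢0 = ℕ.m*n≢0 x y′
    yxy′≢0 : NonZero (y * (x * y′))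
    yxy′≢0 = ℕ.m*n≢0 y (x * y′)
  reorder : ∀ x y′ f → x ℤ.* f ℤ.* y′ ≡ f ℤ.* (x ℤ.* y′)
  reorder = ℤ-Solver.solve-∀
  cross : (+ x ℤ.* (+ (x * y′) ℤ.+ e)) ℤ.* + y′ ≡ + x′ ℤ.* + (y * (x * y′))
  cross = begin
    + x ℤ.* (+ (x * y′) ℤ.+ e) ℤ.* + y′   ≡⟨ reorder (+ x) (+ y′) _ ⟩
    (+ (x * y′) ℤ.+ e) ℤ.* (+ x ℤ.* + y′) ≡⟨ cong₂ ℤ._*_ (sym eq) (sym (ℤ.pos-* x y′)) ⟩
    + (x′ * y) ℤ.* + (x * y′)             ≡⟨ sym (ℤ.pos-* (x′ * y) (x * y′)) ⟩
    + (x′ * y * (x * y′))                 ≡⟨ cong +_ (ℕ.*-assoc x′ y (x * y′)) ⟩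
    + (x′ * (y * (x * y′)))               ≡⟨ ℤ.pos-* x′ (y * (x * y′)) ⟩
    + x′ ℤ.* + (y * (x * y′))             ∎

*-cancelˡ-÷ᵗ : ∀ x y → x ≢ 0ℚ → (x ℚ.* y) ÷ᵗ x ≡ y
*-cancelˡ-÷ᵗ x y x≢0 with x ℚ.≟ 0ℚ
... | yes x≡0  = contradiction x≡0 x≢0
... | no  x≢0′ = begin
  x ℚ.* y ℚ.* ℚ.1/ x   ≡⟨ cong (ℚ._* ℚ.1/ x) (ℚ.*-comm x y) ⟩
  y ℚ.* x ℚ.* ℚ.1/ x   ≡⟨ ℚ.*-assoc y x (ℚ.1/ x) ⟩
  y ℚ.* (x ℚ.* ℚ.1/ x) ≡⟨ cong (ℚ._*_ y) (ℚ.*-inverseʳ x) ⟩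
  y ℚ.* 1ℚ             ≡⟨ ℚ.*-identityʳ y ⟩
  y                    ∎
  where
  open ≡-Reasoning
  instance
    x≢0ℚ : ℚ.NonZero x
    x≢0ℚ = ℚ.≢-nonZero x≢0′

B-positive : ∀ {d} (P m : Fin d → ℕ) → Positive (B P m)
B-positive P m = ℚ.normalize-pos ((P · m) !) (denom P m) {{denom≢0 P m}} {{ℕ._!≢0 (P · m)}}

BN-positive : ∀ {k d} (N : Fin k → Fin d → ℕ) m → Positive (BN N m)
BN-positive {zero}  N m = _
BN-positive {suc k} N m = ℚ.pos*pos⇒pos (B (N zero) m) {{B-positive (N zero) m}}
                                        (BN (λ j → N (suc j)) m) {{BN-positive (λ j → N (suc j)) m}}

BN≢0 : ∀ {k d} (N : Fin k → Fin d → ℕ) m → BN N m ≢ 0ℚ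
BN≢0 N m BN≡0 = ℚ.<⇒≢ (ℚ.positive⁻¹ (BN N m) {{BN-positive N m}}) (sym BN≡0)

unitDenom : ∀ {d} → ℕ → (Fin d → ℕ) → (Fin d → ℕ) → ℕ
unitDenom p P m = prodF (λ i → unitPart p (m i) ^ P i)

numUnits : ∀ {k d} → ℕ → (Fin k → Fin d → ℕ) → (Fin d → ℕ) → ℕ
numUnits p N m = prodF (λ j → unitPart p (N j · m))

denUnits : ∀ {k d} → ℕ → (Fin k → Fin d → ℕ) → (Fin d → ℕ) → ℕ
denUnits p N m = prodF (λ j → unitDenom p (N j) m)

unitDenom≢0 : ∀ {d} p (P m : Fin d → ℕ) → NonZero (unitDenom p P m)
unitDenom≢0 p P m = prodF≢0 _ (λ i → ℕ.m^n≢0 _ (P i) {{unitPart≢0 p (m i)}})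

numUnits≢0 : ∀ {k d} p (N : Fin k → Fin d → ℕ) m → NonZero (numUnits p N m)
numUnits≢0 p N m = prodF≢0 _ (λ j → unitPart≢0 p (N j · m))

denUnits≢0 : ∀ {k d} p (N : Fin k → Fin d → ℕ) m → NonZero (denUnits p N m)
denUnits≢0 p N m = prodF≢0 _ (λ j → unitDenom≢0 p (N j) m)

unitRatio : ∀ {d} → ℕ → (Fin d → ℕ) → (Fin d → ℕ) → ℚ
unitRatio p P m = _/_ (+ unitPart p (P · m)) (unitDenom p P m) {{unitDenom≢0 p P m}}

unitRatioN : ∀ {k d} → ℕ → (Fin k → Fin d → ℕ) → (Fin d → ℕ) → ℚ
unitRatioN p N m = _/_ (+ numUnits p N m) (denUnits p N m) {{denUnits≢0 p N m}}

module _ {p : ℕ} .{{_ : NonZero p}} where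

  [p*m]!^P-split : ∀ m P → ((p * m) !) ^ P ≡ p ^ (P * m) * (m !) ^ P * unitPart p m ^ P
  [p*m]!^P-split m P = begin
    ((p * m) !) ^ P                            ≡⟨ cong (_^ P) ([p*M]!≡p^M*M!*unitPart p m) ⟩
    (p ^ m * m ! * unitPart p m) ^ P           ≡⟨ *-^ (p ^ m * m !) (unitPart p m) P ⟩
    (p ^ m * m !) ^ P * unitPart p m ^ P       ≡⟨ cong (_* unitPart p m ^ P) (*-^ (p ^ m) (m !) P) ⟩
    (p ^ m) ^ P * (m !) ^ P * unitPart p m ^ P ≡⟨ cong (λ e → e * (m !) ^ P * unitPart p m ^ P)
                                                       (trans (ℕ.^-*-assoc p m P) (cong (p ^_) (ℕ.*-comm m P))) ⟩
    p ^ (P * m) * (m !) ^ P * unitPart p m ^ P ∎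
    where open ≡-Reasoning

  denom-scale : ∀ {d} (P : Fin d → ℕ) {m m′ : Fin d → ℕ} → (∀ i → m′ i ≡ p * m i) →
                denom P m′ ≡ p ^ (P · m) * denom P m * unitDenom p P m
  denom-scale P {m} {m′} h = begin
    denom P m′
      ≡⟨ prodF-cong (λ i → trans (cong (λ x → (x !) ^ P i) (h i)) ([p*m]!^P-split (m i) (P i))) ⟩
    prodF (λ i → p ^ (P i * m i) * (m i !) ^ P i * unitPart p (m i) ^ P i)
      ≡⟨ prodF-* (λ i → p ^ (P i * m i) * (m i !) ^ P i) (λ i → unitPart p (m i) ^ P i) ⟩
    prodF (λ i → p ^ (P i * m i) * (m i !) ^ P i) * unitDenom p P m
      ≡⟨ cong (_* unitDenom p P m) (prodF-* (λ i → p ^ (P i * m i)) (λ i → (m i !) ^ P i)) ⟩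
    prodF (λ i → p ^ (P i * m i)) * denom P m * unitDenom p P m
      ≡⟨ cong (λ e → e * denom P m * unitDenom p P m) (prodF-^ p (λ i → P i * m i)) ⟩
    p ^ (P · m) * denom P m * unitDenom p P m
      ∎
    where open ≡-Reasoning

  B-scale : ∀ {d} (P : Fin d → ℕ) {m m′ : Fin d → ℕ} → (∀ i → m′ i ≡ p * m i) →
            B P m′ ≡ B P m ℚ.* unitRatio p P m
  B-scale P {m} {m′} h = sym (trans
    (/-*-/ℕ (S !) (unitPart p S) D V {{denom≢0 P m}} {{unitDenom≢0 p P m}})
    (/-crossℕ (S ! * unitPart p S) ((P · m′) !) (D * V) (denom P m′)
              {{ℕ.m*n≢0 D V {{denom≢0 P m}} {{unitDenom≢0 p P m}}}} {{denom≢0 P m′}} cross))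
    where
    S D V : ℕ
    S = P · m
    D = denom P m
    V = unitDenom p P m
    reorder : ∀ f u π D V → f * u * (π * D * V) ≡ π * f * u * (D * V)
    reorder = ℕ-Solver.solve-∀
    cross : S ! * unitPart p S * denom P m′ ≡ (P · m′) ! * (D * V)
    cross = begin
      S ! * unitPart p S * denom P m′       ≡⟨ cong (S ! * unitPart p S *_) (denom-scale P h) ⟩
      S ! * unitPart p S * (p ^ S * D * V)  ≡⟨ reorder (S !) (unitPart p S) (p ^ S) D V ⟩
      p ^ S * S ! * unitPart p S * (D * V)  ≡⟨ cong (_* (D * V)) (sym ([p*M]!≡p^M*M!*unitPart p S)) ⟩
      (p * S) ! * (D * V)                   ≡⟨ cong (λ x → x ! * (D * V)) (sym (·-scale P p h)) ⟩
      (P · m′) ! * (D * V)                  ∎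
      where open ≡-Reasoning

  BN-scale : ∀ {k d} (N : Fin k → Fin d → ℕ) {m m′ : Fin d → ℕ} → (∀ i → m′ i ≡ p * m i) →
             BN N m′ ≡ BN N m ℚ.* unitRatioN p N m
  BN-scale {zero}  N h = refl
  BN-scale {suc k} N {m} {m′} h = begin
    B (N zero) m′ ℚ.* BN N′ m′
      ≡⟨ cong₂ ℚ._*_ (B-scale (N zero) h) (BN-scale N′ h) ⟩
    B (N zero) m ℚ.* unitRatio p (N zero) m ℚ.* (BN N′ m ℚ.* unitRatioN p N′ m)
      ≡⟨ ℚ-*-interchange (B (N zero) m) (unitRatio p (N zero) m) (BN N′ m) (unitRatioN p N′ m) ⟩
    BN N m ℚ.* (unitRatio p (N zero) m ℚ.* unitRatioN p N′ m)
      ≡⟨ cong (ℚ._*_ (BN N m)) (/-*-/ℕ (unitPart p (N zero · m)) (numUnits p N′ m)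
                                       (unitDenom p (N zero) m) (denUnits p N′ m)
                                       {{unitDenom≢0 p (N zero) m}} {{denUnits≢0 p N′ m}}) ⟩
    BN N m ℚ.* unitRatioN p N m
      ∎
    where
    open ≡-Reasoning
    N′ : Fin k → Fin _ → ℕ
    N′ j = N (suc j)

  BN-scale-÷ᵗ : ∀ {k d} (N : Fin k → Fin d → ℕ) {m m′ : Fin d → ℕ} → (∀ i → m′ i ≡ p * m i) →
                BN N m′ ÷ᵗ BN N m ≡ unitRatioN p N m
  BN-scale-÷ᵗ N {m} h =
    trans (cong (_÷ᵗ BN N m) (BN-scale N h)) (*-cancelˡ-÷ᵗ (BN N m) _ (BN≢0 N m))

module _ (p K : ℕ) where

  unitPart-·-shift : ∀ {d} (P u n : Fin d → ℕ) →
    unitPart p (P · (λ i → u i + K * n i)) ≡ unitPart p (P · u) * unitPart p K ^ (P · n) mod p * K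
  unitPart-·-shift P u n = ≡mod-trans (≡⇒≡mod (cong (unitPart p) (·-shift P u n K)))
                                      (unitPart-+*-≡mod p (P · u) K (P · n))

  unitDenom-shift : ∀ {d} (P u n : Fin d → ℕ) →
    unitDenom p P (λ i → u i + K * n i) ≡ unitDenom p P u * unitPart p K ^ (P · n) mod p * K
  unitDenom-shift P u n = ≡mod-trans (prodF-≡mod-* _ _ _ factor)
    (≡⇒≡mod (cong (unitDenom p P u *_) (prodF-^ (unitPart p K) (λ i → P i * n i))))
    where
    factor : ∀ i → unitPart p (u i + K * n i) ^ P i
                     ≡ unitPart p (u i) ^ P i * unitPart p K ^ (P i * n i) mod p * K
    factor i = ≡mod-trans (^-≡mod (P i) (unitPart-+*-≡mod p (u i) K (n i))) (≡⇒≡mod (begin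
      (unitPart p (u i) * unitPart p K ^ n i) ^ P i       ≡⟨ *-^ (unitPart p (u i)) (unitPart p K ^ n i) (P i) ⟩
      unitPart p (u i) ^ P i * (unitPart p K ^ n i) ^ P i ≡⟨ cong (unitPart p (u i) ^ P i *_)
                                                              (trans (ℕ.^-*-assoc (unitPart p K) (n i) (P i))
                                                                     (cong (unitPart p K ^_) (ℕ.*-comm (n i) (P i)))) ⟩
      unitPart p (u i) ^ P i * unitPart p K ^ (P i * n i) ∎))
      where open ≡-Reasoning

  unitRatioN-shift : ∀ {k d} (N : Fin k → Fin d → ℕ) (u n : Fin d → ℕ) → ∃ λ c →
    unitRatioN p N (λ i → u i + K * n i) ≡ unitRatioN p N u ℚ.*
      (1ℚ ℚ.+ _/_ (+ (p * K) ℤ.* c) (numUnits p N u * denUnits p N (λ i → u i + K * n i))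
                  {{ℕ.m*n≢0 _ _ {{numUnits≢0 p N u}} {{denUnits≢0 p N (λ i → u i + K * n i)}}}})
  unitRatioN-shift N u n = map₂ (λ {c} → /-perturb (numUnits p N u) (denUnits p N u)
                                                    (numUnits p N m′) (denUnits p N m′) (+ (p * K) ℤ.* c)
                                                    {{numUnits≢0 p N u}} {{denUnits≢0 p N u}} {{denUnits≢0 p N m′}})
                                (≡mod⇒∃ cross)
    where
    m′ : Fin _ → ℕ
    m′ i = u i + K * n i
    C : Fin _ → ℕ
    C j = unitPart p K ^ (N j · n)
    cross : numUnits p N m′ * denUnits p N u ≡ numUnits p N u * denUnits p N m′ mod p * K
    cross = ≡mod-cross {b = numUnits p N u}
      (prodF-≡mod-* _ (λ j → unitPart p (N j · u)) C (λ j → unitPart-·-shift (N j) u n))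
      (prodF-≡mod-* _ (λ j → unitDenom p (N j) u) C (λ j → unitDenom-shift (N j) u n))

module _ {p : ℕ} (p-prime : Prime p) where

  private instance
    p≢0 : NonZero p
    p≢0 = prime⇒nonZero p-prime

  p∤1 : ¬ p ∣ℕ 1
  p∤1 p∣1 = ¬prime[1] (subst Prime (∣1⇒≡1 p∣1) p-prime)

  p∤* : ∀ {a b} → ¬ p ∣ℕ a → ¬ p ∣ℕ b → ¬ p ∣ℕ a * b
  p∤* {a} {b} p∤a p∤b p∣ab with euclidsLemma a b p-prime p∣ab
  ... | inj₁ p∣a = p∤a p∣a
  ... | inj₂ p∣b = p∤b p∣b

  p∤^ : ∀ {a} n → ¬ p ∣ℕ a → ¬ p ∣ℕ a ^ n
  p∤^ zero    p∤a = p∤1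
  p∤^ (suc n) p∤a = p∤* p∤a (p∤^ n p∤a)

  p∤prodF : ∀ {d} (f : Fin d → ℕ) → (∀ i → ¬ p ∣ℕ f i) → ¬ p ∣ℕ prodF f
  p∤prodF = prodF-closed (λ a → ¬ p ∣ℕ a) p∤1 p∤*

  p∤rising : ∀ M t → t < p → ¬ p ∣ℕ rising (p * M) t
  p∤rising M zero    _   = p∤1
  p∤rising M (suc t) t<p = p∤* (p∤rising M t (ℕ.<-trans (ℕ.n<1+n t) t<p)) p∤pM+1+t
    where p∤pM+1+t : ¬ p ∣ℕ suc (p * M + t)
          p∤pM+1+t p∣ = ℕ.<⇒≱ t<p (∣⇒≤ (∣m+n∣m⇒∣n (subst (p ∣ℕ_) (sym (ℕ.+-suc (p * M) t)) p∣)
                                                   (m∣m*n M)))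

  p∤unitPart : ∀ M → ¬ p ∣ℕ unitPart p M
  p∤unitPart zero    = p∤1
  p∤unitPart (suc M) = p∤* (p∤unitPart M)
    (p∤rising M (pred p) (subst (pred p <_) (ℕ.suc-pred p) (ℕ.n<1+n (pred p))))

  p∤numUnits*denUnits : ∀ {k d} (N : Fin k → Fin d → ℕ) m m′ →
                        ¬ p ∣ℕ numUnits p N m * denUnits p N m′
  p∤numUnits*denUnits N m m′ = p∤*
    (p∤prodF _ (λ j → p∤unitPart (N j · m)))
    (p∤prodF _ (λ j → p∤prodF _ (λ i → p∤^ (N j i) (p∤unitPart (m′ i)))))

  unitRatioN-shift-InPowZp : ∀ {k d} (N : Fin k → Fin d → ℕ) s (u n : Fin d → ℕ) →
    ∃ λ ε → InPowZp p (suc s) ε × unitRatioN p N (λ i → u i + p ^ s * n i) ≡ unitRatioN p N u ℚ.* (1ℚ ℚ.+ ε)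
  unitRatioN-shift-InPowZp N s u n =
    let c , shift = unitRatioN-shift p (p ^ s) N u n
    in  _ , (c , _ , p∤numUnits*denUnits N u (λ i → u i + p ^ s * n i)
                   , ℕ.m*n≢0 _ _ {{numUnits≢0 p N u}} {{denUnits≢0 p N (λ i → u i + p ^ s * n i)}} , refl) , shift

lemma9 : (p : ℕ) → Prime p → (d k : ℕ) → 1 ≤ d → 1 ≤ k →
    (N : Fin k → Fin d → ℕ) → (s : ℕ) → (u n : Fin d → ℕ) →
    (∀ i → u i < p ^ s) →
    ∃ λ (ε : ℚ) → InPowZp p (suc s) ε ×
      (BN N (λ i → p * u i + p ^ suc s * n i) ÷ᵗ BN N (λ i → u i + p ^ s * n i)
        ≡ (BN N (λ i → p * u i) ÷ᵗ BN N u) ℚ.* (1ℚ ℚ.+ ε))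
lemma9 p p-prime d k _ _ N s u n _ =
  let ε , ε∈ , shift = unitRatioN-shift-InPowZp p-prime N s u n
  in  ε , ε∈ , (begin
  BN N (λ i → p * u i + p ^ suc s * n i) ÷ᵗ BN N m′ ≡⟨ BN-scale-÷ᵗ N (λ i → distrib p (u i) (p ^ s) (n i)) ⟩
  unitRatioN p N m′                                 ≡⟨ shift ⟩
  unitRatioN p N u ℚ.* (1ℚ ℚ.+ ε)                   ≡⟨ cong (ℚ._* (1ℚ ℚ.+ ε)) (sym (BN-scale-÷ᵗ N (λ _ → refl))) ⟩
  (BN N (λ i → p * u i) ÷ᵗ BN N u) ℚ.* (1ℚ ℚ.+ ε)  ∎)
  where
  open ≡-Reasoning
  instance
    p≢0 : NonZero p
    p≢0 = prime⇒nonZero p-prime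
  m′ : Fin d → ℕ
  m′ = λ i → u i + p ^ s * n i
  distrib : ∀ p u P n → p * u + p * P * n ≡ p * (u + P * n)
  distrib = ℕ-Solver.solve-∀
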